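{- Let $p$ be a prime and let $f(x)=\sum_{m=0}^{\infty}B_m\chi(m,x):\mathbb{Z}_p\to\mathbb{Z}_p$ be a 1-Lipschitz function in van der Put expansion satisfying (1) $\sum_{m=0}^{p-1}B_m\equiv0\pmod p$; and (2) $\sum_{m=p^{n-1}}^{p^n-1}B_m\equiv0\pmod{p^n}$ for all $n\ge2$. Then there exists a 1-Lipschitz function $g:\mathbb{Z}_p\to\mathbb{Z}_p$ such that $f(x)=\Delta g(x):=g(x+1)-g(x)$.
   Context: $\mathbb{Z}_p$ is the ring of $p$-adic integers with absolute value $|x|_p=p^{ -\mathrm{ord}(x)}$. A function $f:\mathbb{Z}_p\to\mathbb{Z}_p$ is 1-Lipschitz if $|f(x)-f(y)|_p\le|x-y|_p$ for all $x,y$. For an integer $m>0$ with base-$p$ expansion $m=m_0+m_1p+\dots+m_sp^s$ ($0\le m_i\le p-1$, $m_s\ne0$), put $q(m)=m_sp^s$. The van der Put basis is: for $m>0$, $\chi(m,x)=1$ if $|x-m|_p\le p^{ -\lfloor\log_p m\rfloor-1}$ and $0$ otherwise; $\chi(0,x)=1$ if $|x|_p\le p^{ -1}$ and $0$ otherwise. Every continuous $f:\mathbb{Z}_p\to\mathbb{Z}_p$ has a unique expansion $f(x)=\sum_{m\ge0}B_m\chi(m,x)$ with $B_m\in\mathbb{Z}_p$, where $B_m=f(m)$ for $0\le m\le p-1$ and $B_m=f(m)-f(m-q(m))$ for $m\ge p$. -}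

module Defs where

open import Data.Nat using (ℕ; zero; suc; _+_; _*_; _∸_; _^_; _<_; _<ᵇ_; NonZero)
open import Data.Nat.DivMod using (_/_; _mod_)
open import Data.Nat.Properties using (_<?_)
open import Data.Fin using (Fin; toℕ)
open import Data.Bool using (if_then_else_)
open import Data.List using (List; foldr; applyUpTo)
open import Relation.Binary.PropositionalEquality using (_≡_)
open import Relation.Nullary using (yes; no)

-- p-adic integers as digit streams:  x = Σ_i (x i) p^i  with digits in {0,…,p-1}.
ℤₚ : ℕ → Set
ℤₚ p = ℕ → Fin p

module _ (p : ℕ) .{{_ : NonZero p}} where

  _≈ₚ_ : ℤₚ p → ℤₚ p → Set
  x ≈ₚ y = ∀ i → x i ≡ y i

  -- |x - y|_p ≤ p^{-n}  (x ≡ y mod p^n): the first n digits agree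
  Close : ℕ → ℤₚ p → ℤₚ p → Set
  Close n x y = ∀ i → i < n → x i ≡ y i

  DivByPow : ℕ → ℤₚ p → Set
  DivByPow n x = ∀ i → i < n → toℕ (x i) ≡ 0

  -- 1-Lipschitz: |f x - f y|_p ≤ |x - y|_p  (values of |·|_p are 0 or p^{-n})
  Lipschitz1 : (ℤₚ p → ℤₚ p) → Set
  Lipschitz1 f = ∀ x y n → Close n x y → Close n (f x) (f y)

  ι : ℕ → ℤₚ p
  ι m zero = m mod p
  ι m (suc i) = ι (m / p) i

  0ₚ 1ₚ : ℤₚ p
  0ₚ = ι 0
  1ₚ = ι 1

  carry : ℤₚ p → ℤₚ p → ℕ → ℕ
  carry a b zero = 0
  carry a b (suc i) = (toℕ (a i) + toℕ (b i) + carry a b i) / p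

  _+ₚ_ : ℤₚ p → ℤₚ p → ℤₚ p
  (a +ₚ b) i = (toℕ (a i) + toℕ (b i) + carry a b i) mod p

  borrow : ℤₚ p → ℤₚ p → ℕ → ℕ
  borrow a b zero = 0
  borrow a b (suc i) =
    if toℕ (a i) <ᵇ toℕ (b i) + borrow a b i then 1 else 0

  _-ₚ_ : ℤₚ p → ℤₚ p → ℤₚ p
  (a -ₚ b) i = ((toℕ (a i) + p) ∸ (toℕ (b i) + borrow a b i)) mod p

  sumFromTo : (ℕ → ℤₚ p) → ℕ → ℕ → ℤₚ p
  sumFromTo B a b = foldr _+ₚ_ 0ₚ (applyUpTo (λ k → B (a + k)) (suc b ∸ a))

  -- q(m) = m_s p^s (leading base-p term); fuel argument (fuel m suffices for p ≥ 2)
  qAux : ℕ → ℕ → ℕ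
  qAux zero m = m
  qAux (suc k) m with m <? p
  ... | yes _ = m
  ... | no _ = p * qAux k (m / p)

  q : ℕ → ℕ
  q m = qAux m m

  vdP : (ℤₚ p → ℤₚ p) → ℕ → ℤₚ p
  vdP f m with m <? p
  ... | yes _ = f (ι m)
  ... | no _ = f (ι m) -ₚ f (ι (m ∸ q m))

{-# OPTIONS --safe #-}
module Submission where

-- For natural N let G(N) = Σ_{k<N} f(k); then G(N + 1) − G(N) = f(N), and g is to be the continuous
-- extension of G. On the block P ≤ m < pP (P = p^j, j ≥ 1) the van der Put coefficients are
-- B_m = f(m) − f(m mod P), which gives G(pP) ≡ p·G(P) + Σ_{m=P}^{pP−1} B_m modulo every p^n.
-- Together with the hypotheses this yields p^n ∣ G(p^n) by induction on n.
-- Since f is 1-Lipschitz, f(k) mod p^n depends only on k mod p^n, so G(N) mod p^n depends only on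
-- N mod p^n: the residues of G(x mod p^n) are compatible and define a 1-Lipschitz g with Δg = f.

open import Defs
open import Data.Nat using (ℕ; NonZero; _≤_; _∸_; _^_)
open import Data.Nat.Base
  using (zero; suc; _+_; _*_; _<_; z≤n; s≤s; z<s; s<s; _<ᵇ_; nonTrivial⇒n>1; >-nonZero⁻¹)
open import Data.Nat.Properties
open import Data.Nat.DivMod
open import Data.Nat.Divisibility
  using (_∣_; m%n≡0⇒n∣m; n∣m⇒m%n≡0; ∣n⇒∣m*n; *-monoʳ-∣; n∣m*n; ∣-refl; 1∣_)
open import Data.Nat.Primality using (Prime; prime⇒nonTrivial)
open import Data.Nat.Tactic.RingSolver using (solve-∀)
open import Algebra.Properties.CommutativeSemigroup +-commutativeSemigroup as +-CS using ()
open import Algebra.Properties.CommutativeSemigroup *-commutativeSemigroup as *-CS using ()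
open import Data.Fin.Base using (toℕ)
open import Data.Fin.Properties using (toℕ-fromℕ<; toℕ<n; toℕ-injective)
open import Data.Bool.Base using (true; false; if_then_else_)
open import Data.List.Base using (foldr; applyUpTo)
open import Data.Product using (Σ; _×_; _,_)
open import Data.Sum.Base using (inj₁; inj₂)
open import Data.Empty using (⊥-elim)
open import Relation.Binary.PropositionalEquality
open import Relation.Nullary using (yes; no)
open import Relation.Nullary.Reflects using (ofʸ; ofⁿ)

module _ {d : ℕ} .{{_ : NonZero d}} where

  [m+n%d]%d≡[m+n]%d : ∀ m n → (m + n % d) % d ≡ (m + n) % d
  [m+n%d]%d≡[m+n]%d m n = begin
    (m + n % d) % d           ≡⟨ %-distribˡ-+ m (n % d) d ⟩
    (m % d + n % d % d) % d   ≡⟨ cong (λ z → (m % d + z) % d) (m%n%n≡m%n n d) ⟩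
    (m % d + n % d) % d       ≡⟨ %-distribˡ-+ m n d ⟨
    (m + n) % d               ∎
    where open ≡-Reasoning

  %-cancelʳ-+ : ∀ m n o → (m + o) % d ≡ (n + o) % d → m % d ≡ n % d
  %-cancelʳ-+ m n o eq = trans (undo m) (trans (cong (λ z → (z + c) % d) eq) (sym (undo n)))
    where
      open ≡-Reasoning
      c = d ∸ o % d
      o+c≡ : o + c ≡ suc (o / d) * d
      o+c≡ = begin
        o + c                       ≡⟨ cong (_+ c) (m≡m%n+[m/n]*n o d) ⟩
        o % d + o / d * d + c       ≡⟨ +-CS.xy∙z≈y∙xz (o % d) (o / d * d) c ⟩
        o / d * d + (o % d + c)     ≡⟨ cong (o / d * d +_) (m+[n∸m]≡n (m%n≤n o d)) ⟩
        o / d * d + d               ≡⟨ +-comm (o / d * d) d ⟩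
        suc (o / d) * d             ∎
      undo : ∀ m → m % d ≡ ((m + o) % d + c) % d
      undo m = begin
        m % d                       ≡⟨ [m+kn]%n≡m%n m (suc (o / d)) d ⟨
        (m + suc (o / d) * d) % d   ≡⟨ cong (λ z → (m + z) % d) o+c≡ ⟨
        (m + (o + c)) % d           ≡⟨ cong (_% d) (+-assoc m o c) ⟨
        (m + o + c) % d             ≡⟨ %-distribˡ-+ (m + o) c d ⟩
        ((m + o) % d + c % d) % d   ≡⟨ [m+n%d]%d≡[m+n]%d ((m + o) % d) c ⟩
        ((m + o) % d + c) % d       ∎

sumUpTo : (ℕ → ℕ) → ℕ → ℕ
sumUpTo h zero = 0
sumUpTo h (suc N) = h 0 + sumUpTo (λ k → h (suc k)) N

sumUpTo-+ : ∀ h a b → sumUpTo h (a + b) ≡ sumUpTo h a + sumUpTo (λ k → h (a + k)) b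
sumUpTo-+ h zero b = refl
sumUpTo-+ h (suc a) b =
  trans (cong (h 0 +_) (sumUpTo-+ (λ k → h (suc k)) a b)) (sym (+-assoc (h 0) _ _))

sumUpTo-suc : ∀ h N → sumUpTo h (suc N) ≡ sumUpTo h N + h N
sumUpTo-suc h N = begin
  sumUpTo h (suc N)                    ≡⟨ cong (sumUpTo h) (+-comm 1 N) ⟩
  sumUpTo h (N + 1)                    ≡⟨ sumUpTo-+ h N 1 ⟩
  sumUpTo h N + (h (N + 0) + 0)        ≡⟨ cong (sumUpTo h N +_) (trans (+-identityʳ _) (cong h (+-identityʳ N))) ⟩
  sumUpTo h N + h N                    ∎
  where open ≡-Reasoning

sumUpTo-cong : ∀ {h h'} N → (∀ k → k < N → h k ≡ h' k) → sumUpTo h N ≡ sumUpTo h' N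
sumUpTo-cong zero eq = refl
sumUpTo-cong (suc N) eq = cong₂ _+_ (eq 0 z<s) (sumUpTo-cong N (λ k k<N → eq (suc k) (s<s k<N)))

sumUpTo-distrib-+ : ∀ h h' N → sumUpTo (λ k → h k + h' k) N ≡ sumUpTo h N + sumUpTo h' N
sumUpTo-distrib-+ h h' zero = refl
sumUpTo-distrib-+ h h' (suc N) = trans
  (cong (h 0 + h' 0 +_) (sumUpTo-distrib-+ (λ k → h (suc k)) (λ k → h' (suc k)) N))
  (+-CS.interchange (h 0) (h' 0) _ _)

sumUpTo-periodic : ∀ h Q → (∀ k → h (Q + k) ≡ h k) → ∀ t → sumUpTo h (t * Q) ≡ t * sumUpTo h Q
sumUpTo-periodic h Q per zero = refl
sumUpTo-periodic h Q per (suc t) = trans (sumUpTo-+ h Q (t * Q))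
  (cong (sumUpTo h Q +_) (trans (sumUpTo-cong (t * Q) (λ k _ → per k)) (sumUpTo-periodic h Q per t)))

sumUpTo-cong-% : ∀ {d} .{{_ : NonZero d}} {h h'} N → (∀ k → k < N → h k % d ≡ h' k % d) →
  sumUpTo h N % d ≡ sumUpTo h' N % d
sumUpTo-cong-% zero eq = refl
sumUpTo-cong-% {d} {h} {h'} (suc N) eq = begin
  (h 0 + sumUpTo _ N) % d              ≡⟨ %-distribˡ-+ (h 0) _ d ⟩
  (h 0 % d + sumUpTo _ N % d) % d      ≡⟨ cong₂ (λ a b → (a + b) % d) (eq 0 z<s) tail ⟩
  (h' 0 % d + sumUpTo _ N % d) % d     ≡⟨ %-distribˡ-+ (h' 0) _ d ⟨
  (h' 0 + sumUpTo _ N) % d             ∎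
  where
    open ≡-Reasoning
    tail : sumUpTo (λ k → h (suc k)) N % d ≡ sumUpTo (λ k → h' (suc k)) N % d
    tail = sumUpTo-cong-% N (λ k k<N → eq (suc k) (s<s k<N))

n<p^n : ∀ {p} → 1 < p → ∀ n → n < p ^ n
n<p^n 1<p zero = z<s
n<p^n {p} 1<p (suc n) = ≤-<-trans (n<p^n 1<p n) (^-monoʳ-< p 1<p (n<1+n n))

module _ (p : ℕ) .{{_ : NonZero p}} where

  -- Instance search cannot produce NonZero (p ^ n) (it would have to invert _^_), hence these
  -- operators and the explicit or local instances m^n≢0 p n below.
  infixl 7 _%p^_ _/p^_
  _%p^_ _/p^_ : ℕ → ℕ → ℕ
  m %p^ n = _%_ m (p ^ n) {{m^n≢0 p n}}
  m /p^ n = _/_ m (p ^ n) {{m^n≢0 p n}}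

  trunc : ℕ → ℤₚ p → ℕ
  trunc zero x = 0
  trunc (suc n) x = trunc n x + toℕ (x n) * p ^ n

  trunc<p^n : ∀ n x → trunc n x < p ^ n
  trunc<p^n zero x = z<s
  trunc<p^n (suc n) x =
    ≤-trans (+-monoˡ-< (toℕ (x n) * p ^ n) (trunc<p^n n x)) (*-monoˡ-≤ (p ^ n) (toℕ<n (x n)))

  trunc-%p^ : ∀ n x → trunc n x %p^ n ≡ trunc n x
  trunc-%p^ n x = m<n⇒m%n≡m {{m^n≢0 p n}} (trunc<p^n n x)

  trunc-suc-%p^ : ∀ n x → trunc (suc n) x %p^ n ≡ trunc n x
  trunc-suc-%p^ n x = trans ([m+kn]%n≡m%n (trunc n x) (toℕ (x n)) (p ^ n) {{m^n≢0 p n}}) (trunc-%p^ n x)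

  trunc-suc-injective : ∀ n {x y} → trunc (suc n) x ≡ trunc (suc n) y → trunc n x ≡ trunc n y × x n ≡ y n
  trunc-suc-injective n {x} {y} eq = lower , toℕ-injective (*-cancelʳ-≡ _ _ (p ^ n) {{m^n≢0 p n}}
    (+-cancelˡ-≡ (trunc n x) _ _ (trans eq (cong (_+ toℕ (y n) * p ^ n) (sym lower)))))
    where
      lower : trunc n x ≡ trunc n y
      lower = trans (sym (trunc-suc-%p^ n x)) (trans (cong (_%p^ n) eq) (trunc-suc-%p^ n y))

  Close⇒trunc-≡ : ∀ n {x y} → Close p n x y → trunc n x ≡ trunc n y
  Close⇒trunc-≡ zero close = refl
  Close⇒trunc-≡ (suc n) close = cong₂ (λ t d → t + toℕ d * p ^ n)
    (Close⇒trunc-≡ n (λ i i<n → close i (m<n⇒m<1+n i<n))) (close n (n<1+n n))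

  trunc-≡⇒Close : ∀ n {x y} → trunc n x ≡ trunc n y → Close p n x y
  trunc-≡⇒Close (suc n) eq i (s≤s i≤n) with m≤n⇒m<n∨m≡n i≤n | trunc-suc-injective n eq
  ... | inj₁ i<n | lower , _    = trunc-≡⇒Close n lower i i<n
  ... | inj₂ refl | _ , digit  = digit

  toℕ-ι : ∀ m i → toℕ (ι p m i) ≡ m /p^ i % p
  toℕ-ι m zero = trans (toℕ-fromℕ< _) (cong (_% p) (sym (n/1≡n m)))
  toℕ-ι m (suc i) = trans (toℕ-ι (m / p) i)
    (cong (_% p) (m/n/o≡m/[n*o] m p (p ^ i) {{_}} {{m^n≢0 p i}} {{m^n≢0 p (suc i)}}))

  trunc-ι : ∀ n m → trunc n (ι p m) ≡ m %p^ n
  trunc-ι zero m = sym (n%1≡0 m)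
  trunc-ι (suc n) m = begin
    trunc n (ι p m) + toℕ (ι p m n) * P     ≡⟨ cong₂ (λ r d → r + d * P) (trunc-ι n m) (toℕ-ι m n) ⟩
    m % P + m / P % p * P                   ≡⟨ cong₂ (λ r d → r + d * P) low-part high-digit ⟨
    m % (p * P) % P + m % (p * P) / P * P   ≡⟨ m≡m%n+[m/n]*n (m % (p * P)) P ⟨
    m % (p * P)                             ∎
    where
      open ≡-Reasoning
      P = p ^ n
      instance
        _ = m^n≢0 p n
        _ = m^n≢0 p (suc n)
      low-part : m % (p * P) % P ≡ m % P
      low-part = m∣n⇒o%n%m≡o%m P (p * P) m (n∣m*n p)
      high-digit : m % (p * P) / P ≡ m / P % p
      high-digit = m%[n*o]/o≡m/o%n m p P

  trunc-+ₚ-carry : ∀ n a b → trunc n (_+ₚ_ p a b) + carry p a b n * p ^ n ≡ trunc n a + trunc n b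
  trunc-+ₚ-carry zero a b = refl
  trunc-+ₚ-carry (suc n) a b = begin
    S + toℕ (s mod p) * P + s / p * (p * P)      ≡⟨ cong (λ r → S + r * P + s / p * (p * P)) sₙ≡s%p ⟩
    S + s % p * P + s / p * (p * P)              ≡⟨ regroup S (s % p) (s / p) p P ⟩
    S + (s % p + s / p * p) * P                  ≡⟨ cong (λ z → S + z * P) (m≡m%n+[m/n]*n s p) ⟨
    S + (aₙ + bₙ + c) * P                        ≡⟨ split S aₙ bₙ c P ⟩
    S + c * P + (aₙ * P + bₙ * P)                ≡⟨ cong (_+ (aₙ * P + bₙ * P)) (trunc-+ₚ-carry n a b) ⟩
    trunc n a + trunc n b + (aₙ * P + bₙ * P)    ≡⟨ +-CS.interchange (trunc n a) (trunc n b) _ _ ⟩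
    trunc n a + aₙ * P + (trunc n b + bₙ * P)    ∎
    where
      open ≡-Reasoning
      S = trunc n (_+ₚ_ p a b)
      P = p ^ n
      aₙ = toℕ (a n)
      bₙ = toℕ (b n)
      c = carry p a b n
      s = aₙ + bₙ + c
      sₙ≡s%p : toℕ (s mod p) ≡ s % p
      sₙ≡s%p = toℕ-fromℕ< (m%n<n s p)
      regroup : ∀ S r k p P → S + r * P + k * (p * P) ≡ S + (r + k * p) * P
      regroup = solve-∀
      split : ∀ S a b c P → S + (a + b + c) * P ≡ S + c * P + (a * P + b * P)
      split = solve-∀

  digit-sub : ∀ {a b} → a < p → b ≤ p →
    ((a + p) ∸ b) % p + b ≡ a + (if a <ᵇ b then 1 else 0) * p
  digit-sub {a} {b} a<p b≤p with a <ᵇ b | <ᵇ-reflects-< a b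
  ... | true | ofʸ a<b = begin
    ((a + p) ∸ b) % p + b   ≡⟨ cong (_+ b) (m<n⇒m%n≡m diff<p) ⟩
    (a + p) ∸ b + b         ≡⟨ m∸n+n≡m (≤-trans b≤p (m≤n+m p a)) ⟩
    a + p                   ≡⟨ cong (a +_) (+-identityʳ p) ⟨
    a + 1 * p               ∎
    where
      open ≡-Reasoning
      diff<p : (a + p) ∸ b < p
      diff<p = subst ((a + p) ∸ b <_) (m+n∸m≡n b p)
        (∸-monoˡ-< (+-monoˡ-< p a<b) (≤-trans b≤p (m≤n+m p a)))
  ... | false | ofⁿ a≮b = begin
    ((a + p) ∸ b) % p + b   ≡⟨ cong (λ z → z % p + b) (+-∸-comm p b≤a) ⟩
    (a ∸ b + p) % p + b     ≡⟨ cong (_+ b) ([m+n]%n≡m%n (a ∸ b) p) ⟩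
    (a ∸ b) % p + b         ≡⟨ cong (_+ b) (m<n⇒m%n≡m (≤-<-trans (m∸n≤m a b) a<p)) ⟩
    a ∸ b + b               ≡⟨ m∸n+n≡m b≤a ⟩
    a                       ≡⟨ +-identityʳ a ⟨
    a + 0 * p               ∎
    where
      open ≡-Reasoning
      b≤a : b ≤ a
      b≤a = ≮⇒≥ a≮b

  borrow≤1 : ∀ a b n → borrow p a b n ≤ 1
  borrow≤1 a b zero = z≤n
  borrow≤1 a b (suc n) with toℕ (a n) <ᵇ toℕ (b n) + borrow p a b n
  ... | true = s≤s z≤n
  ... | false = z≤n

  trunc-−ₚ-borrow : ∀ n a b → trunc n (_-ₚ_ p a b) + trunc n b ≡ trunc n a + borrow p a b n * p ^ n
  trunc-−ₚ-borrow zero a b = refl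
  trunc-−ₚ-borrow (suc n) a b = begin
    D + toℕ (s mod p) * P + (trunc n b + bₙ * P)   ≡⟨ cong (λ r → D + r * P + (trunc n b + bₙ * P)) sₙ≡s%p ⟩
    D + s % p * P + (trunc n b + bₙ * P)           ≡⟨ +-CS.interchange D (s % p * P) (trunc n b) (bₙ * P) ⟩
    D + trunc n b + (s % p * P + bₙ * P)           ≡⟨ cong (_+ (s % p * P + bₙ * P)) (trunc-−ₚ-borrow n a b) ⟩
    trunc n a + w * P + (s % p * P + bₙ * P)       ≡⟨ regroup (trunc n a) w P (s % p) bₙ ⟩
    trunc n a + (s % p + (bₙ + w)) * P             ≡⟨ cong (λ z → trunc n a + z * P) (digit-sub aₙ<p bₙ+w≤p) ⟩
    trunc n a + (toℕ (a n) + w' * p) * P           ≡⟨ expand (trunc n a) (toℕ (a n)) w' p P ⟩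
    trunc n a + toℕ (a n) * P + w' * (p * P)       ∎
    where
      open ≡-Reasoning
      D = trunc n (_-ₚ_ p a b)
      P = p ^ n
      bₙ = toℕ (b n)
      w = borrow p a b n
      w' = borrow p a b (suc n)
      aₙ<p : toℕ (a n) < p
      aₙ<p = toℕ<n (a n)
      s = (toℕ (a n) + p) ∸ (bₙ + w)
      sₙ≡s%p : toℕ (s mod p) ≡ s % p
      sₙ≡s%p = toℕ-fromℕ< (m%n<n s p)
      bₙ+w≤p : bₙ + w ≤ p
      bₙ+w≤p = ≤-trans (+-monoʳ-≤ bₙ (borrow≤1 a b n)) (subst (_≤ p) (+-comm 1 bₙ) (toℕ<n (b n)))
      regroup : ∀ A w P x b → A + w * P + (x * P + b * P) ≡ A + (x + (b + w)) * P
      regroup = solve-∀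
      expand : ∀ A a w p P → A + (a + w * p) * P ≡ A + a * P + w * (p * P)
      expand = solve-∀

  trunc-+ₚ : ∀ n a b → trunc n (_+ₚ_ p a b) ≡ (trunc n a + trunc n b) %p^ n
  trunc-+ₚ n a b = begin
    trunc n (_+ₚ_ p a b)                                    ≡⟨ trunc-%p^ n (_+ₚ_ p a b) ⟨
    trunc n (_+ₚ_ p a b) %p^ n                              ≡⟨ [m+kn]%n≡m%n _ (carry p a b n) (p ^ n) ⟨
    (trunc n (_+ₚ_ p a b) + carry p a b n * p ^ n) %p^ n   ≡⟨ cong (_%p^ n) (trunc-+ₚ-carry n a b) ⟩
    (trunc n a + trunc n b) %p^ n                           ∎
    where
      open ≡-Reasoning
      instance _ = m^n≢0 p n

  trunc-−ₚ : ∀ n a b → (trunc n (_-ₚ_ p a b) + trunc n b) %p^ n ≡ trunc n a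
  trunc-−ₚ n a b = begin
    (trunc n (_-ₚ_ p a b) + trunc n b) %p^ n      ≡⟨ cong (_%p^ n) (trunc-−ₚ-borrow n a b) ⟩
    (trunc n a + borrow p a b n * p ^ n) %p^ n   ≡⟨ [m+kn]%n≡m%n (trunc n a) (borrow p a b n) (p ^ n) ⟩
    trunc n a %p^ n                              ≡⟨ trunc-%p^ n a ⟩
    trunc n a                                    ∎
    where
      open ≡-Reasoning
      instance _ = m^n≢0 p n

  trunc-sum : ∀ n h L →
    trunc n (foldr (_+ₚ_ p) (0ₚ p) (applyUpTo h L)) ≡ sumUpTo (λ k → trunc n (h k)) L %p^ n
  trunc-sum n h zero = trunc-ι n 0
  trunc-sum n h (suc L) = begin
    trunc n (_+ₚ_ p (h 0) R)               ≡⟨ trunc-+ₚ n (h 0) R ⟩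
    (trunc n (h 0) + trunc n R) %p^ n      ≡⟨ cong (λ z → (trunc n (h 0) + z) %p^ n) (trunc-sum n (λ k → h (suc k)) L) ⟩
    (trunc n (h 0) + S %p^ n) %p^ n        ≡⟨ [m+n%d]%d≡[m+n]%d {p ^ n} (trunc n (h 0)) S ⟩
    (trunc n (h 0) + S) %p^ n              ∎
    where
      open ≡-Reasoning
      instance _ = m^n≢0 p n
      R = foldr (_+ₚ_ p) (0ₚ p) (applyUpTo (λ k → h (suc k)) L)
      S = sumUpTo (λ k → trunc n (h (suc k))) L

  DivByPow⇒trunc≡0 : ∀ n x → DivByPow p n x → trunc n x ≡ 0
  DivByPow⇒trunc≡0 zero x div = refl
  DivByPow⇒trunc≡0 (suc n) x div = cong₂ (λ t d → t + d * p ^ n)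
    (DivByPow⇒trunc≡0 n x (λ i i<n → div i (m<n⇒m<1+n i<n))) (div n (n<1+n n))

  qAux-≡ : ∀ j k m → j ≤ k → p ^ j ≤ m → m < p ^ suc j → qAux p k m ≡ m /p^ j * p ^ j
  qAux-≡ zero zero m _ _ _ = sym (trans (*-identityʳ _) (n/1≡n m))
  qAux-≡ zero (suc k) m _ _ m<p*1 with m <? p
  ... | yes _ = sym (trans (*-identityʳ _) (n/1≡n m))
  ... | no m≮p = ⊥-elim (m≮p (subst (m <_) (*-identityʳ p) m<p*1))
  qAux-≡ (suc j) (suc k) m (s≤s j≤k) P≤m m<pP with m <? p
  ... | yes m<p = ⊥-elim (<⇒≱ m<p (≤-trans (m≤m*n p (p ^ j) {{m^n≢0 p j}}) P≤m))
  ... | no _ = begin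
    p * qAux p k (m / p)              ≡⟨ cong (p *_) (qAux-≡ j k (m / p) j≤k Q≤m/p m/p<pQ) ⟩
    p * (m / p / Q * Q)               ≡⟨ cong (λ z → p * (z * Q)) (m/n/o≡m/[n*o] m p Q) ⟩
    p * (m /p^ suc j * Q)             ≡⟨ *-CS.x∙yz≈y∙xz p (m /p^ suc j) Q ⟩
    m /p^ suc j * (p * Q)             ∎
    where
      open ≡-Reasoning
      Q = p ^ j
      instance
        _ = m^n≢0 p j
        _ = m^n≢0 p (suc j)
      Q≤m/p : Q ≤ m / p
      Q≤m/p = subst (_≤ m / p) (m*n/n≡m Q p) (/-monoˡ-≤ p (subst (_≤ m) (*-comm p Q) P≤m))
      m/p<pQ : m / p < p * Q
      m/p<pQ = m<n*o⇒m/o<n (subst (m <_) (*-comm p (p * Q)) m<pP)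

  m∸q[m]≡m%p^j : 1 < p → ∀ j m → p ^ j ≤ m → m < p ^ suc j → m ∸ q p m ≡ m %p^ j
  m∸q[m]≡m%p^j 1<p j m P≤m m<pP = begin
    m ∸ q p m               ≡⟨ cong (m ∸_) (qAux-≡ j m m j≤m P≤m m<pP) ⟩
    m ∸ m /p^ j * p ^ j     ≡⟨ m%n≡m∸m/n*n m (p ^ j) {{m^n≢0 p j}} ⟨
    m %p^ j                 ∎
    where
      open ≡-Reasoning
      j≤m : j ≤ m
      j≤m = <⇒≤ (<-≤-trans (n<p^n 1<p j) P≤m)

  vdP-< : ∀ f m → m < p → vdP p f m ≡ f (ι p m)
  vdP-< f m m<p with m <? p
  ... | yes _ = refl
  ... | no m≮p = ⊥-elim (m≮p m<p)

  vdP-≥ : ∀ f m → p ≤ m → vdP p f m ≡ _-ₚ_ p (f (ι p m)) (f (ι p (m ∸ q p m)))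
  vdP-≥ f m p≤m with m <? p
  ... | yes m<p = ⊥-elim (<⇒≱ m<p p≤m)
  ... | no _ = refl

  trunc-+ₚ1ₚ : ∀ n x → trunc n (_+ₚ_ p x (1ₚ p)) ≡ suc (trunc n x) %p^ n
  trunc-+ₚ1ₚ n x = begin
    trunc n (_+ₚ_ p x (1ₚ p))            ≡⟨ trunc-+ₚ n x (1ₚ p) ⟩
    (trunc n x + trunc n (1ₚ p)) %p^ n   ≡⟨ cong (λ z → (trunc n x + z) %p^ n) (trunc-ι n 1) ⟩
    (trunc n x + 1 %p^ n) %p^ n          ≡⟨ [m+n%d]%d≡[m+n]%d {p ^ n} (trunc n x) 1 ⟩
    (trunc n x + 1) %p^ n                ≡⟨ cong (_%p^ n) (+-comm (trunc n x) 1) ⟩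
    suc (trunc n x) %p^ n                ∎
    where
      open ≡-Reasoning
      instance _ = m^n≢0 p n

  ι-trunc-Close : ∀ n x → Close p n (ι p (trunc n x)) x
  ι-trunc-Close n x = trunc-≡⇒Close n (trans (trunc-ι n (trunc n x)) (trunc-%p^ n x))

  module Antiderivative (f : ℤₚ p → ℤₚ p) (f-lip : Lipschitz1 p f) where

    fMod : ℕ → ℕ → ℕ
    fMod n k = trunc n (f (ι p k))

    sumF : ℕ → ℕ → ℕ
    sumF n = sumUpTo (fMod n)

    fMod-cong : ∀ n {k k'} → k %p^ n ≡ k' %p^ n → fMod n k ≡ fMod n k'
    fMod-cong n {k} {k'} eq = Close⇒trunc-≡ n (f-lip (ι p k) (ι p k') n
      (trunc-≡⇒Close n (trans (trunc-ι n k) (trans eq (sym (trunc-ι n k'))))))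

    fMod-trunc : ∀ n x → fMod n (trunc n x) ≡ trunc n (f x)
    fMod-trunc n x = Close⇒trunc-≡ n (f-lip _ x n (ι-trunc-Close n x))

    sumF-suc-%p^ : ∀ n N → sumF (suc n) N %p^ n ≡ sumF n N %p^ n
    sumF-suc-%p^ n N = sumUpTo-cong-% {p ^ n} {{m^n≢0 p n}} N
      (λ k _ → trans (trunc-suc-%p^ n (f (ι p k))) (sym (trunc-%p^ n (f (ι p k)))))

    sumF-%p^ : ∀ n → p ^ n ∣ sumF n (p ^ n) → ∀ N → sumF n N %p^ n ≡ sumF n (N %p^ n) %p^ n
    sumF-%p^ n M∣sumF N = begin
      sumF n N % M                                                ≡⟨ cong (λ z → sumF n z % M) N≡tM+r ⟩
      sumF n (t * M + r) % M                                      ≡⟨ cong (_% M) (sumUpTo-+ (fMod n) (t * M) r) ⟩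
      (sumF n (t * M) + sumUpTo (λ k → fMod n (t * M + k)) r) % M ≡⟨ cong₂ (λ a b → (a + b) % M) full-periods tail ⟩
      (t * sumF n M + sumF n r) % M                               ≡⟨ %-remove-+ˡ (sumF n r) (∣n⇒∣m*n t M∣sumF) ⟩
      sumF n r % M                                                ∎
      where
        open ≡-Reasoning
        M = p ^ n
        instance _ = m^n≢0 p n
        t = N / M
        r = N % M
        N≡tM+r : N ≡ t * M + r
        N≡tM+r = trans (m≡m%n+[m/n]*n N M) (+-comm r (t * M))
        full-periods : sumF n (t * M) ≡ t * sumF n M
        full-periods = sumUpTo-periodic (fMod n) M (λ k → fMod-cong n (%-remove-+ˡ k {M} ∣-refl)) t
        tail : sumUpTo (λ k → fMod n (t * M + k)) r ≡ sumF n r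
        tail = sumUpTo-cong r (λ k _ → fMod-cong n (%-remove-+ˡ k {M} (n∣m*n t)))

    fMod-above-p^j : 1 < p → ∀ n j → 1 ≤ j → ∀ k → k < (p ∸ 1) * p ^ j →
      fMod n (p ^ j + k) %p^ n ≡ (trunc n (vdP p f (p ^ j + k)) + fMod n (k %p^ j)) %p^ n
    fMod-above-p^j 1<p n j 1≤j k k<L = begin
      fMod n (P + k) %p^ n                                ≡⟨ trunc-%p^ n (f (ι p (P + k))) ⟩
      fMod n (P + k)                                      ≡⟨ trunc-−ₚ n (f (ι p (P + k))) (f (ι p r)) ⟨
      (trunc n (_-ₚ_ p (f (ι p (P + k))) (f (ι p r))) + fMod n r) %p^ n
        ≡⟨ cong₂ (λ v w → (trunc n v + fMod n w) %p^ n) (sym (vdP-≥ f (P + k) p≤P+k)) r≡k%P ⟩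
      (trunc n (vdP p f (P + k)) + fMod n (k %p^ j)) %p^ n ∎
      where
        open ≡-Reasoning
        P = p ^ j
        instance _ = m^n≢0 p j
        r = P + k ∸ q p (P + k)
        p≤P+k : p ≤ P + k
        p≤P+k = ≤-trans (subst (_≤ P) (*-identityʳ p) (^-monoʳ-≤ p 1≤j)) (m≤m+n P k)
        P+k<pP : P + k < p * P
        P+k<pP = subst (P + k <_) (cong (_* P) (m+[n∸m]≡n (>-nonZero⁻¹ p))) (+-monoʳ-< P k<L)
        r≡k%P : r ≡ k %p^ j
        r≡k%P = trans (m∸q[m]≡m%p^j 1<p j (P + k) (m≤m+n P k) P+k<pP) (%-remove-+ˡ k {P} ∣-refl)

    sumF-p^suc : 1 < p → ∀ n j → 1 ≤ j →
      sumF n (p ^ suc j) %p^ n ≡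
        (p * sumF n (p ^ j) + trunc n (sumFromTo p (vdP p f) (p ^ j) (p ^ suc j ∸ 1))) %p^ n
    sumF-p^suc 1<p n j 1≤j = begin
      sumF n (p * P) % M                     ≡⟨ cong (λ z → sumF n z % M) P+L≡pP ⟨
      sumF n (P + L) % M                     ≡⟨ cong (_% M) (sumUpTo-+ (fMod n) P L) ⟩
      (S + upper) % M                        ≡⟨ [m+n%d]%d≡[m+n]%d {M} S upper ⟨
      (S + upper % M) % M                    ≡⟨ cong (λ z → (S + z) % M) upper≡ ⟩
      (S + (A + (p ∸ 1) * S) % M) % M        ≡⟨ [m+n%d]%d≡[m+n]%d {M} S (A + (p ∸ 1) * S) ⟩
      (S + (A + (p ∸ 1) * S)) % M            ≡⟨ cong (_% M) collect ⟩
      (p * S + A) % M                        ≡⟨ [m+n%d]%d≡[m+n]%d {M} (p * S) A ⟨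
      (p * S + A % M) % M                    ≡⟨ cong (λ z → (p * S + z) % M) block ⟨
      (p * S + trunc n (sumFromTo p (vdP p f) P (p * P ∸ 1))) % M ∎
      where
        open ≡-Reasoning
        M = p ^ n
        P = p ^ j
        L = (p ∸ 1) * P
        instance
          _ = m^n≢0 p n
          _ = m^n≢0 p j
        S = sumF n P
        upper = sumUpTo (λ k → fMod n (P + k)) L
        V : ℕ → ℕ
        V k = trunc n (vdP p f (P + k))
        A = sumUpTo V L
        1≤p : 1 ≤ p
        1≤p = >-nonZero⁻¹ p
        P+L≡pP : P + L ≡ p * P
        P+L≡pP = cong (_* P) (m+[n∸m]≡n 1≤p)
        repeat : sumUpTo (λ k → fMod n (k % P)) L ≡ (p ∸ 1) * S
        repeat = trans (sumUpTo-periodic _ P (λ k → cong (fMod n) (%-remove-+ˡ k {P} ∣-refl)) (p ∸ 1))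
          (cong ((p ∸ 1) *_) (sumUpTo-cong P (λ k k<P → cong (fMod n) (m<n⇒m%n≡m k<P))))
        upper≡ : upper % M ≡ (A + (p ∸ 1) * S) % M
        upper≡ = begin
          upper % M                                      ≡⟨ sumUpTo-cong-% {M} L (fMod-above-p^j 1<p n j 1≤j) ⟩
          sumUpTo (λ k → V k + fMod n (k % P)) L % M     ≡⟨ cong (_% M) (sumUpTo-distrib-+ V _ L) ⟩
          (A + sumUpTo (λ k → fMod n (k % P)) L) % M     ≡⟨ cong (λ z → (A + z) % M) repeat ⟩
          (A + (p ∸ 1) * S) % M                          ∎
        collect : S + (A + (p ∸ 1) * S) ≡ p * S + A
        collect = begin
          S + (A + (p ∸ 1) * S)   ≡⟨ +-CS.x∙yz≈y∙xz S A _ ⟩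
          A + (S + (p ∸ 1) * S)   ≡⟨ cong (λ c → A + c * S) (m+[n∸m]≡n 1≤p) ⟩
          A + p * S               ≡⟨ +-comm A (p * S) ⟩
          p * S + A               ∎
        block-length : suc (p * P ∸ 1) ∸ P ≡ L
        block-length = begin
          suc (p * P ∸ 1) ∸ P   ≡⟨ cong (_∸ P) (m+[n∸m]≡n (m^n>0 p (suc j))) ⟩
          p * P ∸ P             ≡⟨ cong (p * P ∸_) (*-identityˡ P) ⟨
          p * P ∸ 1 * P         ≡⟨ *-distribʳ-∸ P p 1 ⟨
          L                     ∎
        block : trunc n (sumFromTo p (vdP p f) P (p * P ∸ 1)) ≡ A % M
        block = trans (trunc-sum n (λ k → vdP p f (P + k)) (suc (p * P ∸ 1) ∸ P))
          (cong (λ l → sumUpTo V l % M) block-length)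

    p∣sumF[p] : DivByPow p 1 (sumFromTo p (vdP p f) 0 (p ∸ 1)) → p ^ 1 ∣ sumF 1 (p ^ 1)
    p∣sumF[p] h₁ = m%n≡0⇒n∣m _ _ {{m^n≢0 p 1}} (begin
      sumF 1 (p * 1) %p^ 1                                      ≡⟨ cong (λ z → sumF 1 z %p^ 1) p*1≡1+[p∸1] ⟩
      sumF 1 (suc (p ∸ 1)) %p^ 1                                ≡⟨ cong (_%p^ 1) (sumUpTo-cong (suc (p ∸ 1)) digits) ⟩
      sumUpTo (λ k → trunc 1 (vdP p f k)) (suc (p ∸ 1)) %p^ 1   ≡⟨ trunc-sum 1 (vdP p f) (suc (p ∸ 1)) ⟨
      trunc 1 (sumFromTo p (vdP p f) 0 (p ∸ 1))                 ≡⟨ DivByPow⇒trunc≡0 1 _ h₁ ⟩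
      0                                                         ∎)
      where
        open ≡-Reasoning
        1+[p∸1]≡p : suc (p ∸ 1) ≡ p
        1+[p∸1]≡p = m+[n∸m]≡n (>-nonZero⁻¹ p)
        p*1≡1+[p∸1] : p * 1 ≡ suc (p ∸ 1)
        p*1≡1+[p∸1] = trans (*-identityʳ p) (sym 1+[p∸1]≡p)
        digits : ∀ k → k < suc (p ∸ 1) → fMod 1 k ≡ trunc 1 (vdP p f k)
        digits k k<p = cong (trunc 1) (sym (vdP-< f k (subst (k <_) 1+[p∸1]≡p k<p)))

    p^n∣sumF[p^n]-step : 1 < p → ∀ n → p ^ suc n ∣ sumF (suc n) (p ^ suc n) →
      DivByPow p (2 + n) (sumFromTo p (vdP p f) (p ^ suc n) (p ^ (2 + n) ∸ 1)) →
      p ^ (2 + n) ∣ sumF (2 + n) (p ^ (2 + n))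
    p^n∣sumF[p^n]-step 1<p n P∣sumF hₙ = m%n≡0⇒n∣m _ _ {{m^n≢0 p (2 + n)}} (begin
      sumF (2 + n) (p * P) %p^ (2 + n)            ≡⟨ sumF-p^suc 1<p (2 + n) (suc n) (s≤s z≤n) ⟩
      (p * S + trunc (2 + n) block) %p^ (2 + n)   ≡⟨ cong (λ z → (p * S + z) %p^ (2 + n)) block≡0 ⟩
      (p * S + 0) %p^ (2 + n)                     ≡⟨ cong (_%p^ (2 + n)) (+-identityʳ (p * S)) ⟩
      p * S %p^ (2 + n)                           ≡⟨ n∣m⇒m%n≡0 _ _ {{m^n≢0 p (2 + n)}} (*-monoʳ-∣ p P∣S) ⟩
      0                                           ∎)
      where
        open ≡-Reasoning
        P = p ^ suc n
        S = sumF (2 + n) P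
        block = sumFromTo p (vdP p f) P (p * P ∸ 1)
        block≡0 : trunc (2 + n) block ≡ 0
        block≡0 = DivByPow⇒trunc≡0 (2 + n) block hₙ
        P∣S : P ∣ S
        P∣S = m%n≡0⇒n∣m _ _ {{m^n≢0 p (suc n)}}
          (trans (sumF-suc-%p^ (suc n) P) (n∣m⇒m%n≡0 _ _ {{m^n≢0 p (suc n)}} P∣sumF))

    p^n∣sumF[p^n] : 1 < p →
      DivByPow p 1 (sumFromTo p (vdP p f) 0 (p ∸ 1)) →
      ((n : ℕ) → 2 ≤ n → DivByPow p n (sumFromTo p (vdP p f) (p ^ (n ∸ 1)) (p ^ n ∸ 1))) →
      ∀ n → p ^ n ∣ sumF n (p ^ n)
    p^n∣sumF[p^n] 1<p h₁ hₙ zero = 1∣ _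
    p^n∣sumF[p^n] 1<p h₁ hₙ (suc zero) = p∣sumF[p] h₁
    p^n∣sumF[p^n] 1<p h₁ hₙ (suc (suc n)) =
      p^n∣sumF[p^n]-step 1<p n (p^n∣sumF[p^n] 1<p h₁ hₙ (suc n)) (hₙ (2 + n) (s≤s (s≤s z≤n)))

    g : ℤₚ p → ℤₚ p
    g x i = ι p (sumF (suc i) (trunc (suc i) x)) i

    g-Lipschitz : Lipschitz1 p g
    g-Lipschitz x y n close i i<n = cong (λ t → ι p (sumF (suc i) t) i)
      (Close⇒trunc-≡ (suc i) (λ j j≤i → close j (<-≤-trans j≤i i<n)))

    module _ (p^n∣sumF : ∀ n → p ^ n ∣ sumF n (p ^ n)) where

      trunc-g : ∀ n x → trunc n (g x) ≡ sumF n (trunc n x) %p^ n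
      trunc-g zero x = refl
      trunc-g (suc n) x = trans (cong (_+ toℕ (ι p X n) * p ^ n) lower) (trunc-ι (suc n) X)
        where
          open ≡-Reasoning
          X = sumF (suc n) (trunc (suc n) x)
          lower : trunc n (g x) ≡ trunc n (ι p X)
          lower = begin
            trunc n (g x)                              ≡⟨ trunc-g n x ⟩
            sumF n (trunc n x) %p^ n                   ≡⟨ cong (λ t → sumF n t %p^ n) (trunc-suc-%p^ n x) ⟨
            sumF n (trunc (suc n) x %p^ n) %p^ n       ≡⟨ sumF-%p^ n (p^n∣sumF n) (trunc (suc n) x) ⟨
            sumF n (trunc (suc n) x) %p^ n             ≡⟨ sumF-suc-%p^ n (trunc (suc n) x) ⟨
            X %p^ n                                    ≡⟨ trunc-ι n X ⟨
            trunc n (ι p X)                            ∎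

      trunc-Δg : ∀ n x → trunc n (_-ₚ_ p (g (_+ₚ_ p x (1ₚ p))) (g x)) ≡ trunc n (f x)
      trunc-Δg n x = begin
        trunc n Δ                    ≡⟨ trunc-%p^ n Δ ⟨
        trunc n Δ % M                ≡⟨ %-cancelʳ-+ {M} (trunc n Δ) (trunc n (f x)) (sumF n t) shifted ⟩
        trunc n (f x) % M            ≡⟨ trunc-%p^ n (f x) ⟩
        trunc n (f x)                ∎
        where
          open ≡-Reasoning
          M = p ^ n
          instance _ = m^n≢0 p n
          t = trunc n x
          x+1 = _+ₚ_ p x (1ₚ p)
          Δ = _-ₚ_ p (g x+1) (g x)
          shifted : (trunc n Δ + sumF n t) % M ≡ (trunc n (f x) + sumF n t) % M
          shifted = begin
            (trunc n Δ + sumF n t) % M              ≡⟨ [m+n%d]%d≡[m+n]%d {M} (trunc n Δ) (sumF n t) ⟨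
            (trunc n Δ + sumF n t % M) % M          ≡⟨ cong (λ z → (trunc n Δ + z) % M) (trunc-g n x) ⟨
            (trunc n Δ + trunc n (g x)) % M         ≡⟨ trunc-−ₚ n (g x+1) (g x) ⟩
            trunc n (g x+1)                         ≡⟨ trunc-g n x+1 ⟩
            sumF n (trunc n x+1) % M                ≡⟨ cong (λ z → sumF n z % M) (trunc-+ₚ1ₚ n x) ⟩
            sumF n (suc t % M) % M                  ≡⟨ sumF-%p^ n (p^n∣sumF n) (suc t) ⟨
            sumF n (suc t) % M                      ≡⟨ cong (_% M) (sumUpTo-suc (fMod n) t) ⟩
            (sumF n t + fMod n t) % M               ≡⟨ cong (λ z → (sumF n t + z) % M) (fMod-trunc n x) ⟩
            (sumF n t + trunc n (f x)) % M          ≡⟨ cong (_% M) (+-comm (sumF n t) (trunc n (f x))) ⟩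
            (trunc n (f x) + sumF n t) % M          ∎

      Δg≈f : (x : ℤₚ p) → _≈ₚ_ p (f x) (_-ₚ_ p (g (_+ₚ_ p x (1ₚ p))) (g x))
      Δg≈f x i = trunc-≡⇒Close (suc i) (sym (trunc-Δg (suc i) x)) i (n<1+n i)

proposition3p6 : (p : ℕ) .{{_ : NonZero p}} → Prime p →
    (f : ℤₚ p → ℤₚ p) → Lipschitz1 p f →
    DivByPow p 1 (sumFromTo p (vdP p f) 0 (p ∸ 1)) →
    ((n : ℕ) → 2 ≤ n →
      DivByPow p n (sumFromTo p (vdP p f) (p ^ (n ∸ 1)) (p ^ n ∸ 1))) →
    Σ (ℤₚ p → ℤₚ p) (λ g → Lipschitz1 p g ×
      ((x : ℤₚ p) → _≈ₚ_ p (f x) (_-ₚ_ p (g (_+ₚ_ p x (1ₚ p))) (g x))))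
proposition3p6 p p-prime f f-lip h₁ hₙ = g , g-Lipschitz , Δg≈f (p^n∣sumF[p^n] 1<p h₁ hₙ)
  where
    open Antiderivative p f f-lip
    1<p : 1 < p
    1<p = nonTrivial⇒n>1 p {{prime⇒nonTrivial p-prime}}
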